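{- Let $x,y$ be complex numbers with $x\neq 0$, $y\neq 0$, $x^2+4y\neq 0$. For every positive integer $n$, $$2y\sum_{k=0}^{\lfloor (n-1)/2\rfloor}\binom{n}{2k+1}F_{2k}(x,y)\,x^{n-2k-1}=-\Big[F_{n+1}(x,y)-(y-2x^2)F_{n-1}(3x,\,y-2x^2)-xF_n(3x,\,y-2x^2)\Big].$$
   Context: For complex parameters $a,b$, the bivariate Fibonacci polynomials are defined by $F_0(a,b)=0$, $F_1(a,b)=1$ and $F_n(a,b)=aF_{n-1}(a,b)+bF_{n-2}(a,b)$ for $n\ge 2$. -}

module Defs where

open import Level using (Level)
import Data.Nat as ℕ
open ℕ using (ℕ; zero; suc; _∸_)
open import Data.Nat.DivMod using (_/_)
open import Data.Nat.Combinatorics using (_C_)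
open import Algebra.Bundles using (CommutativeRing; Semiring)
import Algebra.Definitions.RawSemiring as RS

module _ {c ℓ : Level} (R : CommutativeRing c ℓ) where
  open CommutativeRing R

  Fib : ℕ → Carrier → Carrier → Carrier
  Fib zero          a b = 0#
  Fib (suc zero)    a b = 1#
  Fib (suc (suc n)) a b = a * Fib (suc n) a b + b * Fib n a b

  sumTo : ℕ → (ℕ → Carrier) → Carrier
  sumTo zero    f = f 0
  sumTo (suc m) f = sumTo m f + f (suc m)

  _×ᴿ_ : ℕ → Carrier → Carrier
  _×ᴿ_ = RS._×_ (Semiring.rawSemiring semiring)

  _^ᴿ_ : Carrier → ℕ → Carrier
  _^ᴿ_ = RS._^_ (Semiring.rawSemiring semiring)

  lhs8 : Carrier → Carrier → ℕ → Carrier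
  lhs8 x y n =
    (2 ×ᴿ 1#) * y *
      sumTo ((n ∸ 1) / 2)
        (λ k → (n C (2 ℕ.* k ℕ.+ 1)) ×ᴿ (Fib (2 ℕ.* k) x y * (x ^ᴿ (n ∸ (2 ℕ.* k) ∸ 1))))

  rhs8 : Carrier → Carrier → ℕ → Carrier
  rhs8 x y n =
    - (Fib (suc n) x y
       - (y - (2 ×ᴿ 1#) * (x * x)) * Fib (n ∸ 1) ((3 ×ᴿ 1#) * x) (y - (2 ×ᴿ 1#) * (x * x))
       - x * Fib n ((3 ×ᴿ 1#) * x) (y - (2 ×ᴿ 1#) * (x * x)))

module Submission where

-- Write Tₛ f n = Σ_{j ≤ n} C(n,j) f_j s^(n-j) for the binomial transform. If f satisfies the
-- Fibonacci recurrence with parameters (a, b), Pascal's rule shows that Tₛ f satisfies it with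
-- parameters (a + 2s, b - s(a + s)): the characteristic roots are shifted by s. With s = x this
-- sends F(x, y) to G = F(3x, y - 2x²) and H = F(-x, y) back to F(x, y). As H_j = (-1)^(j+1) F_j,
-- the sequence D_j = (F_{j+1} - H_{j+1}) - x (F_j + H_j) vanishes at even j and equals 2y F_{j-1}
-- at odd j, so Tₓ D n is the left-hand side, while linearity of Tₓ evaluates it to the right-hand side.

open import Defs
open import Level using (Level)
open import Data.Nat using (ℕ; _≥_)
open import Algebra.Bundles using (CommutativeRing)
open import Relation.Nullary using (¬_)

import Algebra.Solver.Ring.AlmostCommutativeRing as ACR
open import Data.Integer as ℤ using (ℤ; +_; -[1+_]; _⊖_; _◃_; sign; ∣_∣)
import Data.Integer.Properties as ℤ
open import Data.Maybe using (Maybe; just; nothing)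
import Data.Nat as ℕ
open import Data.Nat using (zero; suc; _∸_; _<_; s≤s; _<?_)
open import Data.Nat.Combinatorics using (_C_; k>n⇒nCk≡0; nCk+nC[k+1]≡[n+1]C[k+1])
open import Data.Nat.Divisibility using (n∣m*n)
open import Data.Nat.DivMod using (_/_; m*n/n≡m; +-distrib-/-∣ʳ)
import Data.Nat.Properties as ℕ
open import Data.Sign as Sign using (Sign)
open import Relation.Binary.PropositionalEquality as ≡ using (_≡_)
open import Relation.Nullary using (yes; no)

-- Algebra.Solver.Ring must decide equality of coefficients, which R need not allow;
-- ℤ serves as coefficient ring through its canonical map into R.
module IntegerCoefficientSolver {c ℓ : Level} (R : CommutativeRing c ℓ) where
  open CommutativeRing R
  open import Relation.Binary.Reasoning.Setoid setoid
  open import Algebra.Properties.Semiring.Mult semiring using (_×_; ×-homo-+; ×1-homo-*)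
  open import Algebra.Properties.Ring ring using (-‿distribˡ-*; -‿distribʳ-*; -‿involutive; -0#≈0#)
  open import Algebra.Properties.AbelianGroup +-abelianGroup using (⁻¹-∙-comm)

  private
    ⟦_⟧ℤ : ℤ → Carrier
    ⟦ + n ⟧ℤ      = n × 1#
    ⟦ -[1+ n ] ⟧ℤ = - (suc n × 1#)

    signed : Sign → Carrier → Carrier
    signed Sign.+ z = z
    signed Sign.- z = - z

    signed-cong : ∀ s {a b} → a ≈ b → signed s a ≈ signed s b
    signed-cong Sign.+ a≈b = a≈b
    signed-cong Sign.- a≈b = -‿cong a≈b

    signed-* : ∀ s t a b → signed (s Sign.* t) (a * b) ≈ signed s a * signed t b
    signed-* Sign.+ Sign.+ a b = refl
    signed-* Sign.+ Sign.- a b = -‿distribʳ-* a b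
    signed-* Sign.- Sign.+ a b = -‿distribˡ-* a b
    signed-* Sign.- Sign.- a b = begin
      a * b             ≈⟨ -‿involutive (a * b) ⟨
      - - (a * b)       ≈⟨ -‿cong (-‿distribˡ-* a b) ⟩
      - (- a * b)       ≈⟨ -‿distribʳ-* (- a) b ⟩
      - a * - b         ∎

    ⟦⟧≈signed-abs : ∀ i → ⟦ i ⟧ℤ ≈ signed (sign i) (∣ i ∣ × 1#)
    ⟦⟧≈signed-abs (+ n)    = refl
    ⟦⟧≈signed-abs -[1+ n ] = refl

    ⟦◃⟧ : ∀ s n → ⟦ s ◃ n ⟧ℤ ≈ signed s (n × 1#)
    ⟦◃⟧ Sign.+ zero    = refl
    ⟦◃⟧ Sign.- zero    = sym -0#≈0#
    ⟦◃⟧ Sign.+ (suc n) = refl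
    ⟦◃⟧ Sign.- (suc n) = refl

    ⟦⊖⟧ : ∀ m n → ⟦ m ⊖ n ⟧ℤ ≈ m × 1# - n × 1#
    ⟦⊖⟧ zero    zero    = sym (-‿inverseʳ 0#)
    ⟦⊖⟧ zero    (suc n) = sym (+-identityˡ _)
    ⟦⊖⟧ (suc m) zero    = sym (trans (+-congˡ -0#≈0#) (+-identityʳ _))
    ⟦⊖⟧ (suc m) (suc n) = begin
      ⟦ suc m ⊖ suc n ⟧ℤ          ≡⟨ ≡.cong ⟦_⟧ℤ (ℤ.[1+m]⊖[1+n]≡m⊖n m n) ⟩
      ⟦ m ⊖ n ⟧ℤ                  ≈⟨ ⟦⊖⟧ m n ⟩
      m × 1# - n × 1#             ≈⟨ cancelˡ 1# (m × 1#) (n × 1#) ⟨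
      (1# + m × 1#) - (1# + n × 1#) ∎
      where
      cancelˡ : ∀ o a b → (o + a) - (o + b) ≈ a - b
      cancelˡ o a b = begin
        (o + a) - (o + b)     ≈⟨ +-congˡ (⁻¹-∙-comm o b) ⟨
        (o + a) + (- o - b)   ≈⟨ +-congʳ (+-comm o a) ⟩
        (a + o) + (- o - b)   ≈⟨ +-assoc a o _ ⟩
        a + (o + (- o - b))   ≈⟨ +-congˡ (+-assoc o (- o) (- b)) ⟨
        a + ((o - o) - b)     ≈⟨ +-congˡ (+-congʳ (-‿inverseʳ o)) ⟩
        a + (0# - b)          ≈⟨ +-congˡ (+-identityˡ _) ⟩
        a - b                 ∎

    ⟦+⟧ : ∀ i j → ⟦ i ℤ.+ j ⟧ℤ ≈ ⟦ i ⟧ℤ + ⟦ j ⟧ℤ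
    ⟦+⟧ (+ m)    (+ n)    = ×-homo-+ 1# m n
    ⟦+⟧ (+ m)    -[1+ n ] = ⟦⊖⟧ m (suc n)
    ⟦+⟧ -[1+ m ] (+ n)    = trans (⟦⊖⟧ n (suc m)) (+-comm _ _)
    ⟦+⟧ -[1+ m ] -[1+ n ] = begin
      - (suc (suc (m ℕ.+ n)) × 1#)  ≡⟨ ≡.cong (λ k → - (suc k × 1#)) (ℕ.+-suc m n) ⟨
      - ((suc m ℕ.+ suc n) × 1#)    ≈⟨ -‿cong (×-homo-+ 1# (suc m) (suc n)) ⟩
      - (suc m × 1# + suc n × 1#)   ≈⟨ ⁻¹-∙-comm _ _ ⟨
      - (suc m × 1#) - suc n × 1#   ∎

    ⟦*⟧ : ∀ i j → ⟦ i ℤ.* j ⟧ℤ ≈ ⟦ i ⟧ℤ * ⟦ j ⟧ℤ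
    ⟦*⟧ i j = begin
      ⟦ (sign i Sign.* sign j) ◃ (∣ i ∣ ℕ.* ∣ j ∣) ⟧ℤ       ≈⟨ ⟦◃⟧ (sign i Sign.* sign j) (∣ i ∣ ℕ.* ∣ j ∣) ⟩
      signed (sign i Sign.* sign j) ((∣ i ∣ ℕ.* ∣ j ∣) × 1#) ≈⟨ signed-cong (sign i Sign.* sign j) (×1-homo-* ∣ i ∣ ∣ j ∣) ⟩
      signed (sign i Sign.* sign j) (∣ i ∣ × 1# * ∣ j ∣ × 1#) ≈⟨ signed-* (sign i) (sign j) _ _ ⟩
      signed (sign i) (∣ i ∣ × 1#) * signed (sign j) (∣ j ∣ × 1#) ≈⟨ *-cong (⟦⟧≈signed-abs i) (⟦⟧≈signed-abs j) ⟨
      ⟦ i ⟧ℤ * ⟦ j ⟧ℤ                                         ∎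

    ⟦-⟧ : ∀ i → ⟦ ℤ.- i ⟧ℤ ≈ - ⟦ i ⟧ℤ
    ⟦-⟧ (+ zero)  = sym -0#≈0#
    ⟦-⟧ (+ suc n) = refl
    ⟦-⟧ -[1+ n ]  = sym (-‿involutive _)

    ⟦⟧-homomorphism : ℤ.+-*-rawRing ACR.-Raw-AlmostCommutative⟶ ACR.fromCommutativeRing R
    ⟦⟧-homomorphism = record
      { ⟦_⟧    = ⟦_⟧ℤ
      ; +-homo = ⟦+⟧
      ; *-homo = ⟦*⟧
      ; -‿homo = ⟦-⟧
      ; 0-homo = refl
      ; 1-homo = +-identityʳ 1#
      }

    ⟦⟧-≟ : ∀ i j → Maybe (⟦ i ⟧ℤ ≈ ⟦ j ⟧ℤ)
    ⟦⟧-≟ i j with i ℤ.≟ j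
    ... | yes ≡.refl = just refl
    ... | no _       = nothing

  open import Algebra.Solver.Ring ℤ.+-*-rawRing (ACR.fromCommutativeRing R) ⟦⟧-homomorphism ⟦⟧-≟ public

-- Even numbers are written k * 2 rather than 2 * k: suc k * 2 reduces to suc (suc (k * 2)),
-- so recursions over even and odd numbers unfold definitionally.
data Parity : ℕ → Set where
  even : ∀ p → Parity (p ℕ.* 2)
  odd  : ∀ p → Parity (suc (p ℕ.* 2))

parity : ∀ n → Parity n
parity zero = even 0
parity (suc n) with parity n
... | even p = odd p
... | odd p  = even (suc p)

even/2 : ∀ p → p ℕ.* 2 / 2 ≡ p
even/2 p = m*n/n≡m p 2

odd/2 : ∀ p → suc (p ℕ.* 2) / 2 ≡ p
odd/2 p = ≡.trans (+-distrib-/-∣ʳ 1 {p ℕ.* 2} {2} (n∣m*n p)) (even/2 p)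

module _ {c ℓ : Level} (R : CommutativeRing c ℓ) where
  open CommutativeRing R
  open import Relation.Binary.Reasoning.Setoid setoid
  open import Algebra.Properties.Semiring.Mult semiring using (_×_; ×-congʳ; ×-homo-+; ×-comm-*)
  open import Algebra.Properties.CommutativeMonoid.Mult +-commutativeMonoid using (×-distrib-+)
  open import Algebra.Properties.CommutativeSemigroup +-commutativeSemigroup using (interchange)
  open import Algebra.Properties.CommutativeSemigroup *-commutativeSemigroup using (x∙yz≈y∙xz)
  open import Algebra.Properties.Semiring.Exp semiring using (_^_)
  open import Algebra.Properties.Ring ring using (-1*x≈-x; -0#≈0#)
  open IntegerCoefficientSolver R using (solve; _:=_; _:+_; _:*_; _:-_; :-_)

  sumTo-cong : ∀ m {f g} → (∀ j → f j ≈ g j) → sumTo R m f ≈ sumTo R m g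
  sumTo-cong zero    f≈g = f≈g 0
  sumTo-cong (suc m) f≈g = +-cong (sumTo-cong m f≈g) (f≈g (suc m))

  sumTo-+ : ∀ m f g → sumTo R m (λ j → f j + g j) ≈ sumTo R m f + sumTo R m g
  sumTo-+ zero    f g = refl
  sumTo-+ (suc m) f g = trans (+-congʳ (sumTo-+ m f g)) (interchange _ _ _ _)

  sumTo-*ˡ : ∀ m a f → sumTo R m (λ j → a * f j) ≈ a * sumTo R m f
  sumTo-*ˡ zero    a f = refl
  sumTo-*ˡ (suc m) a f = trans (+-congʳ (sumTo-*ˡ m a f)) (sym (distribˡ a _ _))

  sumTo-shift : ∀ m f → sumTo R (suc m) f ≈ f 0 + sumTo R m (λ j → f (suc j))
  sumTo-shift zero    f = refl
  sumTo-shift (suc m) f = trans (+-congʳ (sumTo-shift m f)) (+-assoc _ _ _)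

  sumTo-pairs : ∀ p f → sumTo R (suc (p ℕ.* 2)) f ≈ sumTo R p (λ k → f (k ℕ.* 2) + f (suc (k ℕ.* 2)))
  sumTo-pairs zero    f = refl
  sumTo-pairs (suc p) f = trans (+-assoc _ _ _) (+-congʳ (sumTo-pairs p f))

  sumTo-pairs-even≈0 : ∀ {f} → (∀ k → f (k ℕ.* 2) ≈ 0#) →
                       ∀ p → sumTo R (suc (p ℕ.* 2)) f ≈ sumTo R p (λ k → f (suc (k ℕ.* 2)))
  sumTo-pairs-even≈0 {f} f-even≈0 p = begin
    sumTo R (suc (p ℕ.* 2)) f                               ≈⟨ sumTo-pairs p f ⟩
    sumTo R p (λ k → f (k ℕ.* 2) + f (suc (k ℕ.* 2)))       ≈⟨ sumTo-cong p (λ k → +-congʳ (f-even≈0 k)) ⟩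
    sumTo R p (λ k → 0# + f (suc (k ℕ.* 2)))                ≈⟨ sumTo-cong p (λ k → +-identityˡ _) ⟩
    sumTo R p (λ k → f (suc (k ℕ.* 2)))                     ∎

  sumTo-odd-terms : ∀ {f} → (∀ k → f (k ℕ.* 2) ≈ 0#) →
                    ∀ m → sumTo R (suc m) f ≈ sumTo R (m / 2) (λ k → f (suc (k ℕ.* 2)))
  sumTo-odd-terms {f} f-even≈0 m with parity m
  ... | even p rewrite even/2 p = sumTo-pairs-even≈0 f-even≈0 p
  ... | odd p rewrite odd/2 p = begin
    sumTo R (suc (p ℕ.* 2)) f + f (suc p ℕ.* 2)       ≈⟨ +-congˡ (f-even≈0 (suc p)) ⟩
    sumTo R (suc (p ℕ.* 2)) f + 0#                    ≈⟨ +-identityʳ _ ⟩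
    sumTo R (suc (p ℕ.* 2)) f                         ≈⟨ sumTo-pairs-even≈0 f-even≈0 p ⟩
    sumTo R p (λ k → f (suc (k ℕ.* 2)))               ∎

  binomialTransform : Carrier → (ℕ → Carrier) → ℕ → Carrier
  binomialTransform s f n = sumTo R n (λ j → (n C j) × (f j * s ^ (n ∸ j)))

  module _ (s : Carrier) where

    binomialTransform-cong : ∀ n {f g} → (∀ j → f j ≈ g j) →
                             binomialTransform s f n ≈ binomialTransform s g n
    binomialTransform-cong n f≈g = sumTo-cong n (λ j → ×-congʳ (n C j) (*-congʳ (f≈g j)))

    binomialTransform-+ : ∀ n f g → binomialTransform s (λ j → f j + g j) n
                                    ≈ binomialTransform s f n + binomialTransform s g n
    binomialTransform-+ n f g = trans (sumTo-cong n summand) (sumTo-+ n _ _)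
      where
      summand : ∀ j → (n C j) × ((f j + g j) * s ^ (n ∸ j))
                      ≈ (n C j) × (f j * s ^ (n ∸ j)) + (n C j) × (g j * s ^ (n ∸ j))
      summand j = trans (×-congʳ (n C j) (distribʳ _ (f j) (g j))) (×-distrib-+ _ _ (n C j))

    binomialTransform-*ˡ : ∀ n a f → binomialTransform s (λ j → a * f j) n ≈ a * binomialTransform s f n
    binomialTransform-*ˡ n a f = trans (sumTo-cong n summand) (sumTo-*ˡ n a _)
      where
      summand : ∀ j → (n C j) × (a * f j * s ^ (n ∸ j)) ≈ a * (n C j) × (f j * s ^ (n ∸ j))
      summand j = trans (×-congʳ (n C j) (*-assoc a (f j) _)) (sym (×-comm-* (n C j) a _))

    binomialTransform-- : ∀ n f g → binomialTransform s (λ j → f j - g j) n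
                                    ≈ binomialTransform s f n - binomialTransform s g n
    binomialTransform-- n f g = begin
      binomialTransform s (λ j → f j - g j) n
        ≈⟨ binomialTransform-+ n f (λ j → - g j) ⟩
      binomialTransform s f n + binomialTransform s (λ j → - g j) n
        ≈⟨ +-congˡ (binomialTransform-cong n (λ j → -1*x≈-x (g j))) ⟨
      binomialTransform s f n + binomialTransform s (λ j → - 1# * g j) n
        ≈⟨ +-congˡ (trans (binomialTransform-*ˡ n (- 1#) g) (-1*x≈-x _)) ⟩
      binomialTransform s f n - binomialTransform s g n ∎

    ^-∸-suc : ∀ {n j} → j < n → s ^ (n ∸ j) ≈ s * s ^ (n ∸ suc j)
    ^-∸-suc {suc n} {zero}  _         = refl
    ^-∸-suc {suc n} {suc j} (s≤s j<n) = ^-∸-suc j<n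

    -- For j ≥ n both sides vanish because n C suc j = 0, whatever truncated subtraction gives.
    binomialSummand-factor : ∀ n j u → (n C suc j) × (u * s ^ (n ∸ j)) ≈ s * (n C suc j) × (u * s ^ (n ∸ suc j))
    binomialSummand-factor n j u with j <? n
    ... | yes j<n = begin
      (n C suc j) × (u * s ^ (n ∸ j))             ≈⟨ ×-congʳ (n C suc j) (*-congˡ (^-∸-suc j<n)) ⟩
      (n C suc j) × (u * (s * s ^ (n ∸ suc j)))   ≈⟨ ×-congʳ (n C suc j) (x∙yz≈y∙xz u s _) ⟩
      (n C suc j) × (s * (u * s ^ (n ∸ suc j)))   ≈⟨ ×-comm-* (n C suc j) s _ ⟨
      s * (n C suc j) × (u * s ^ (n ∸ suc j))     ∎
    ... | no j≮n rewrite k>n⇒nCk≡0 (s≤s (ℕ.≮⇒≥ j≮n)) = sym (zeroʳ s)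

    binomialTransform-zero : ∀ f → binomialTransform s f 0 ≈ f 0
    binomialTransform-zero f = trans (+-identityʳ _) (*-identityʳ _)

    binomialTransform-suc : ∀ n f → binomialTransform s f (suc n)
                                    ≈ s * binomialTransform s f n + binomialTransform s (λ j → f (suc j)) n
    binomialTransform-suc n f = begin
      sumTo R (suc n) h                                      ≈⟨ sumTo-shift n h ⟩
      h 0 + sumTo R n (λ j → h (suc j))                      ≈⟨ +-congˡ (sumTo-cong n pascal) ⟩
      h 0 + sumTo R n (λ j → t j + u j)                      ≈⟨ +-congˡ (sumTo-+ n t u) ⟩
      h 0 + (T′ + sumTo R n u)                               ≈⟨ +-congˡ (+-congˡ (sumTo-cong n (λ j → binomialSummand-factor n j (f (suc j))))) ⟩
      h 0 + (T′ + sumTo R n (λ j → s * k (suc j)))           ≈⟨ +-cong h0≈s*k0 (+-congˡ (sumTo-*ˡ n s _)) ⟩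
      s * k 0 + (T′ + s * sumTo R n (λ j → k (suc j)))       ≈⟨ solve 4 (λ s a t b → s :* a :+ (t :+ s :* b) := s :* (a :+ b) :+ t) refl s (k 0) T′ _ ⟩
      s * (k 0 + sumTo R n (λ j → k (suc j))) + T′           ≈⟨ +-congʳ (*-congˡ (sumTo-shift n k)) ⟨
      s * (binomialTransform s f n + k (suc n)) + T′         ≈⟨ +-congʳ (*-congˡ (trans (+-congˡ k[1+n]≈0) (+-identityʳ _))) ⟩
      s * binomialTransform s f n + T′                       ∎
      where
      T′ : Carrier
      T′ = binomialTransform s (λ j → f (suc j)) n
      h k t u : ℕ → Carrier
      h j = (suc n C j) × (f j * s ^ (suc n ∸ j))
      k j = (n C j) × (f j * s ^ (n ∸ j))
      t j = (n C j) × (f (suc j) * s ^ (n ∸ j))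
      u j = (n C suc j) × (f (suc j) * s ^ (n ∸ j))
      pascal : ∀ j → h (suc j) ≈ t j + u j
      pascal j = begin
        (suc n C suc j) × (f (suc j) * s ^ (n ∸ j))           ≡⟨ ≡.cong (_× (f (suc j) * s ^ (n ∸ j))) (nCk+nC[k+1]≡[n+1]C[k+1] n j) ⟨
        (n C j ℕ.+ n C suc j) × (f (suc j) * s ^ (n ∸ j))     ≈⟨ ×-homo-+ _ (n C j) (n C suc j) ⟩
        t j + u j                                             ∎
      h0≈s*k0 : h 0 ≈ s * k 0
      h0≈s*k0 = sym (trans (×-comm-* 1 s _) (×-congʳ 1 (x∙yz≈y∙xz s (f 0) _)))
      k[1+n]≈0 : k (suc n) ≈ 0#
      k[1+n]≈0 rewrite k>n⇒nCk≡0 (ℕ.n<1+n n) = refl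

  Fib-cong : ∀ {a a′ b b′} → a ≈ a′ → b ≈ b′ → ∀ n → Fib R n a b ≈ Fib R n a′ b′
  Fib-cong a≈a′ b≈b′ zero          = refl
  Fib-cong a≈a′ b≈b′ (suc zero)    = refl
  Fib-cong a≈a′ b≈b′ (suc (suc n)) =
    +-cong (*-cong a≈a′ (Fib-cong a≈a′ b≈b′ (suc n))) (*-cong b≈b′ (Fib-cong a≈a′ b≈b′ n))

  module _ (a b : Carrier) where

    Fib-neg-even : ∀ k → Fib R (k ℕ.* 2) (- a) b ≈ - Fib R (k ℕ.* 2) a b
    Fib-neg-odd  : ∀ k → Fib R (suc (k ℕ.* 2)) (- a) b ≈ Fib R (suc (k ℕ.* 2)) a b
    Fib-neg-even zero    = sym -0#≈0#
    Fib-neg-even (suc k) =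
      trans (+-cong (*-congˡ (Fib-neg-odd k)) (*-congˡ (Fib-neg-even k)))
            (solve 4 (λ a b u v → :- a :* u :+ b :* (:- v) := :- (a :* u :+ b :* v)) refl a b _ _)
    Fib-neg-odd zero    = refl
    Fib-neg-odd (suc k) =
      trans (+-cong (*-congˡ (Fib-neg-even (suc k))) (*-congˡ (Fib-neg-odd k)))
            (solve 4 (λ a b u v → :- a :* (:- u) :+ b :* v := a :* u :+ b :* v) refl a b _ _)

  module _ (s a b : Carrier) where
    private
      f g : ℕ → Carrier
      f j = Fib R j a b
      g j = Fib R j (a + s + s) (b - s * (a + s))
      T : (ℕ → Carrier) → ℕ → Carrier
      T = binomialTransform s

    binomialTransform-Fib     : ∀ n → binomialTransform s (λ j → Fib R j a b) n
                                      ≈ Fib R n (a + s + s) (b - s * (a + s))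
    binomialTransform-Fib-suc : ∀ n → binomialTransform s (λ j → Fib R (suc j) a b) n
                                      ≈ Fib R (suc n) (a + s + s) (b - s * (a + s)) - s * Fib R n (a + s + s) (b - s * (a + s))
    binomialTransform-Fib zero    = binomialTransform-zero s f
    binomialTransform-Fib (suc n) = begin
      T f (suc n)                           ≈⟨ binomialTransform-suc s n f ⟩
      s * T f n + T (λ j → f (suc j)) n     ≈⟨ +-cong (*-congˡ (binomialTransform-Fib n)) (binomialTransform-Fib-suc n) ⟩
      s * g n + (g (suc n) - s * g n)       ≈⟨ solve 3 (λ s u v → s :* u :+ (v :- s :* u) := v) refl s _ _ ⟩
      g (suc n)                             ∎
    binomialTransform-Fib-suc zero    = trans (binomialTransform-zero s (λ j → f (suc j)))
      (sym (trans (+-congˡ (trans (-‿cong (zeroʳ s)) -0#≈0#)) (+-identityʳ 1#)))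
    binomialTransform-Fib-suc (suc n) = begin
      T f′ (suc n)                                              ≈⟨ binomialTransform-suc s n f′ ⟩
      s * T f′ n + T (λ j → a * f′ j + b * f j) n               ≈⟨ +-congˡ (binomialTransform-+ s n _ _) ⟩
      s * T f′ n + (T (λ j → a * f′ j) n + T (λ j → b * f j) n) ≈⟨ +-congˡ (+-cong (binomialTransform-*ˡ s n a f′) (binomialTransform-*ˡ s n b f)) ⟩
      s * T f′ n + (a * T f′ n + b * T f n)                     ≈⟨ +-cong (*-congˡ IH′) (+-cong (*-congˡ IH′) (*-congˡ (binomialTransform-Fib n))) ⟩
      s * (g (suc n) - s * g n) + (a * (g (suc n) - s * g n) + b * g n)
        ≈⟨ solve 5 (λ s a b u v → s :* (v :- s :* u) :+ (a :* (v :- s :* u) :+ b :* u)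
                               := ((a :+ s :+ s) :* v :+ (b :- s :* (a :+ s)) :* u) :- s :* v) refl s a b _ _ ⟩
      g (suc (suc n)) - s * g (suc n)                           ∎
      where
      f′ : ℕ → Carrier
      f′ j = f (suc j)
      IH′ : T f′ n ≈ g (suc n) - s * g n
      IH′ = binomialTransform-Fib-suc n

module _ {c ℓ : Level} (R : CommutativeRing c ℓ) (x y : CommutativeRing.Carrier R) where
  open CommutativeRing R
  open import Relation.Binary.Reasoning.Setoid setoid
  open import Algebra.Properties.Semiring.Mult semiring using (_×_; ×-congʳ; ×-comm-*)
  open import Algebra.Properties.Semiring.Exp semiring using (_^_)
  open IntegerCoefficientSolver R using (solve; _:=_; _:+_; _:*_; _:-_; :-_; con)

  F G H : ℕ → Carrier
  F n = Fib R n x y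
  G n = Fib R n ((3 × 1#) * x) (y - (2 × 1#) * (x * x))
  H n = Fib R n (- x) y

  shifted-F≈G : ∀ n → Fib R n (x + x + x) (y - x * (x + x)) ≈ G n
  shifted-F≈G = Fib-cong R (solve 1 (λ x → x :+ x :+ x := con (+ 3) :* x) refl x)
                          (solve 2 (λ x y → y :- x :* (x :+ x) := y :- con (+ 2) :* (x :* x)) refl x y)

  shifted-H≈F : ∀ n → Fib R n (- x + x + x) (y - x * (- x + x)) ≈ F n
  shifted-H≈F = Fib-cong R (solve 1 (λ x → :- x :+ x :+ x := x) refl x)
                          (solve 2 (λ x y → y :- x :* (:- x :+ x) := y) refl x y)

  binomialTransform-F : ∀ n → binomialTransform R x F n ≈ G n
  binomialTransform-F n = trans (binomialTransform-Fib R x x y n) (shifted-F≈G n)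

  binomialTransform-F-suc : ∀ n → binomialTransform R x (λ j → F (suc j)) n ≈ G (suc n) - x * G n
  binomialTransform-F-suc n = trans (binomialTransform-Fib-suc R x x y n)
                                    (+-cong (shifted-F≈G (suc n)) (-‿cong (*-congˡ (shifted-F≈G n))))

  binomialTransform-H : ∀ n → binomialTransform R x H n ≈ F n
  binomialTransform-H n = trans (binomialTransform-Fib R x (- x) y n) (shifted-H≈F n)

  binomialTransform-H-suc : ∀ n → binomialTransform R x (λ j → H (suc j)) n ≈ F (suc n) - x * F n
  binomialTransform-H-suc n = trans (binomialTransform-Fib-suc R x (- x) y n)
                                    (+-cong (shifted-H≈F (suc n)) (-‿cong (*-congˡ (shifted-H≈F n))))

  D : ℕ → Carrier
  D j = (F (suc j) - H (suc j)) - x * (F j + H j)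

  D-even : ∀ k → D (k ℕ.* 2) ≈ 0#
  D-even k = trans (+-cong (+-congˡ (-‿cong (Fib-neg-odd R x y k)))
                           (-‿cong (*-congˡ (+-congˡ (Fib-neg-even R x y k)))))
                   (solve 3 (λ x u v → (u :- u) :- x :* (v :+ :- v) := con (+ 0)) refl x _ _)

  D-odd : ∀ k → D (suc (k ℕ.* 2)) ≈ (2 × 1#) * y * F (k ℕ.* 2)
  D-odd k = trans (+-cong (+-congˡ (-‿cong (Fib-neg-even R x y (suc k))))
                          (-‿cong (*-congˡ (+-congˡ (Fib-neg-odd R x y k)))))
                  (solve 4 (λ x y u v → (x :* u :+ y :* v :- :- (x :* u :+ y :* v)) :- x :* (u :+ u)
                                        := con (+ 2) :* y :* v) refl x y _ _)

  binomialTransform-D : ∀ m → binomialTransform R x D (suc m) ≈ rhs8 R x y (suc m)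
  binomialTransform-D m = begin
    T D n                                                    ≈⟨ binomialTransform-- R x n _ _ ⟩
    T (λ j → F (suc j) - H (suc j)) n - T (λ j → x * (F j + H j)) n
      ≈⟨ +-cong (binomialTransform-- R x n _ _) (-‿cong (trans (binomialTransform-*ˡ R x n x _) (*-congˡ (binomialTransform-+ R x n F H)))) ⟩
    (T (λ j → F (suc j)) n - T (λ j → H (suc j)) n) - x * (T F n + T H n)
      ≈⟨ +-cong (+-cong (binomialTransform-F-suc n) (-‿cong (binomialTransform-H-suc n)))
                (-‿cong (*-congˡ (+-cong (binomialTransform-F n) (binomialTransform-H n)))) ⟩
    (G (suc n) - x * G n - (F (suc n) - x * F n)) - x * (G n + F n)
      ≈⟨ solve 6 (λ x y g₀ g₁ f₁ f₂ →
           (((con (+ 3) :* x) :* g₁ :+ (y :- con (+ 2) :* (x :* x)) :* g₀) :- x :* g₁ :- (f₂ :- x :* f₁)) :- x :* (g₁ :+ f₁)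
           := :- (f₂ :- (y :- con (+ 2) :* (x :* x)) :* g₀ :- x :* g₁))
         refl x y (G m) (G (suc m)) (F (suc m)) (F (suc (suc m))) ⟩
    rhs8 R x y n                                             ∎
    where
    n : ℕ
    n = suc m
    T : (ℕ → Carrier) → ℕ → Carrier
    T = binomialTransform R x

  lhs8≈binomialTransform-D : ∀ m → lhs8 R x y (suc m) ≈ binomialTransform R x D (suc m)
  lhs8≈binomialTransform-D m = begin
    (2 × 1#) * y * sumTo R (m / 2) (λ k → (n C (2 ℕ.* k ℕ.+ 1)) × (F (2 ℕ.* k) * x ^ (n ∸ 2 ℕ.* k ∸ 1)))
      ≈⟨ sumTo-*ˡ R (m / 2) _ _ ⟨
    sumTo R (m / 2) (λ k → (2 × 1#) * y * (n C (2 ℕ.* k ℕ.+ 1)) × (F (2 ℕ.* k) * x ^ (n ∸ 2 ℕ.* k ∸ 1)))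
      ≈⟨ sumTo-cong R (m / 2) odd-summand ⟩
    sumTo R (m / 2) (λ k → summand (suc (k ℕ.* 2)))
      ≈⟨ sumTo-odd-terms R even-summand≈0 m ⟨
    binomialTransform R x D n ∎
    where
    n : ℕ
    n = suc m
    summand : ℕ → Carrier
    summand j = (n C j) × (D j * x ^ (n ∸ j))
    even-summand≈0 : ∀ k → summand (k ℕ.* 2) ≈ 0#
    even-summand≈0 k = begin
      (n C (k ℕ.* 2)) × (D (k ℕ.* 2) * x ^ (n ∸ k ℕ.* 2)) ≈⟨ ×-congʳ (n C (k ℕ.* 2)) (*-congʳ (D-even k)) ⟩
      (n C (k ℕ.* 2)) × (0# * x ^ (n ∸ k ℕ.* 2))        ≈⟨ ×-comm-* (n C (k ℕ.* 2)) 0# _ ⟨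
      0# * (n C (k ℕ.* 2)) × x ^ (n ∸ k ℕ.* 2)          ≈⟨ zeroˡ _ ⟩
      0#                                                ∎
    odd-summand : ∀ k → (2 × 1#) * y * (n C (2 ℕ.* k ℕ.+ 1)) × (F (2 ℕ.* k) * x ^ (n ∸ 2 ℕ.* k ∸ 1))
                        ≈ summand (suc (k ℕ.* 2))
    odd-summand k rewrite ℕ.*-comm 2 k | ℕ.∸-+-assoc n (k ℕ.* 2) 1 | ℕ.+-comm (k ℕ.* 2) 1 = begin
      (2 × 1#) * y * (n C j) × (F (k ℕ.* 2) * x ^ (n ∸ j)) ≈⟨ ×-comm-* (n C j) _ _ ⟩
      (n C j) × ((2 × 1#) * y * (F (k ℕ.* 2) * x ^ (n ∸ j))) ≈⟨ ×-congʳ (n C j) (*-assoc _ _ _) ⟨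
      (n C j) × ((2 × 1#) * y * F (k ℕ.* 2) * x ^ (n ∸ j)) ≈⟨ ×-congʳ (n C j) (*-congʳ (D-odd k)) ⟨
      summand j ∎
      where
      j : ℕ
      j = suc (k ℕ.* 2)

mainTheorem8 : ∀ {c ℓ : Level} (R : CommutativeRing c ℓ) →
    (x y : CommutativeRing.Carrier R) →
    ¬ (CommutativeRing._≈_ R x (CommutativeRing.0# R)) →
    ¬ (CommutativeRing._≈_ R y (CommutativeRing.0# R)) →
    ¬ (CommutativeRing._≈_ R
         (CommutativeRing._+_ R (CommutativeRing._*_ R x x)
            (CommutativeRing._*_ R (_×ᴿ_ R 4 (CommutativeRing.1# R)) y))
         (CommutativeRing.0# R)) →
    (n : ℕ) → n ≥ 1 →
    CommutativeRing._≈_ R (lhs8 R x y n) (rhs8 R x y n)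
-- The identity holds in every commutative ring.
mainTheorem8 R x y _ _ _ (suc m) _ =
  CommutativeRing.trans R (lhs8≈binomialTransform-D R x y m) (binomialTransform-D R x y m)
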